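{- Let $G$ be a graph on $n$ vertices with maximum degree $\Delta\geq 2$. Then $$\log_\Delta\Big(\frac{n+1}{2}\Big)\leq \operatorname{cdim}(G).$$
   Context: All graphs are nonempty, finite, simple and undirected. For distinct vertices $v,w$ of a graph $G$, $\kappa(v,w)$ denotes the maximum number of internally vertex-disjoint $v$–$w$ paths in $G$; by convention $\kappa(v,v)=\infty$. For an ordered vertex set $W=\{w_1,\ldots,w_k\}\subseteq V(G)$, the connectivity representation of $v$ is $r(v,W)=[\kappa(v,w_1),\ldots,\kappa(v,w_k)]$. $W$ is resolving for $G$ if $r(v_1,W)=r(v_2,W)$ implies $v_1=v_2$ for all $v_1,v_2\in V(G)$. The connectivity dimension $\operatorname{cdim}(G)$ is the minimum cardinality of a resolving set of $G$. -}

module Defs where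

open import Data.Nat using (ℕ; _≤_; _⊔_)
open import Data.Bool using (Bool; T)
open import Data.Fin using (Fin)
open import Data.List using (List; []; _∷_; _++_; length; filter; map; foldr; allFin)
open import Data.Maybe using (Maybe; just; nothing)
open import Data.Product using (Σ; _×_; ∃)
open import Data.Sum using (_⊎_)
open import Data.Empty using (⊥)
open import Relation.Nullary using (¬_)
open import Relation.Binary.PropositionalEquality using (_≡_; _≢_)
open import Data.List.Membership.Propositional using (_∈_)
open import Data.List.Relation.Unary.Linked using (Linked)
open import Data.List.Relation.Unary.Unique.Propositional using (Unique)
open import Function.Definitions using (Injective)
open import Relation.Nullary.Decidable using (does)
open import Data.Bool.Properties using (T?)

record Graph (n : ℕ) : Set where
  field
    adj     : Fin n → Fin n → Bool
    adj-sym : ∀ u v → adj u v ≡ adj v u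
    irrefl  : ∀ v → adj v v ≡ Data.Bool.false
open Graph public

degree : ∀ {n} → Graph n → Fin n → ℕ
degree G v = length (filter (λ w → T? (adj G v w)) (allFin _))

maxDegree : ∀ {n} → Graph n → ℕ
maxDegree G = foldr _⊔_ 0 (map (degree G) (allFin _))

-- A v–w path, given by its list of internal vertices `us`:
-- the vertex sequence v ∷ us ++ [w] has consecutive vertices adjacent
-- and all vertices distinct.
IsPath : ∀ {n} → Graph n → Fin n → Fin n → List (Fin n) → Set
IsPath G v w us =
  Linked (λ a b → T (adj G a b)) (v ∷ us ++ w ∷ [])
  × Unique (v ∷ us ++ w ∷ [])

HasDisjointPaths : ∀ {n} → Graph n → Fin n → Fin n → ℕ → Set
HasDisjointPaths {n} G v w k =
  Σ (Fin k → List (Fin n)) λ P →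
    (∀ i → IsPath G v w (P i))
    × (∀ i j → i ≢ j → (P i ≢ P j) × (∀ x → x ∈ P i → x ∈ P j → ⊥))

-- Extended naturals: nothing = ∞, just k = k.
ℕ∞ : Set
ℕ∞ = Maybe ℕ

-- Conn G v w c  :  κ(v,w) = c   (κ(v,v) = ∞ by convention; for v ≠ w,
-- κ(v,w) is the maximum number of internally vertex-disjoint v–w paths).
Conn : ∀ {n} → Graph n → Fin n → Fin n → ℕ∞ → Set
Conn G v w c =
  (v ≡ w × c ≡ nothing)
  ⊎ (v ≢ w × Σ ℕ λ k → c ≡ just k × HasDisjointPaths G v w k
        × (∀ m → HasDisjointPaths G v w m → m ≤ k))

SameRep : ∀ {n k} → Graph n → (Fin k → Fin n) → Fin n → Fin n → Set
SameRep G W v₁ v₂ =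
  ∀ i c₁ c₂ → Conn G v₁ (W i) c₁ → Conn G v₂ (W i) c₂ → c₁ ≡ c₂

Resolving : ∀ {n k} → Graph n → (Fin k → Fin n) → Set
Resolving G W =
  Injective _≡_ _≡_ W × (∀ v₁ v₂ → SameRep G W v₁ v₂ → v₁ ≡ v₂)

IsCdim : ∀ {n} → Graph n → ℕ → Set
IsCdim {n} G d =
  (Σ (Fin d → Fin n) λ W → Resolving G W)
  × (∀ k (W : Fin k → Fin n) → Resolving G W → d ≤ k)

{-# OPTIONS --safe #-}
-- Let W be a resolving set of size d and Δ the maximum degree. For v ≠ w, κ(v,w) is 0 exactly
-- when v and w lie in different components, and lies in 1 … Δ otherwise. The non-landmark
-- vertices of a component containing b landmarks have representation 0 at every other landmark,
-- so they are told apart by b digits in 1 … Δ and there are at most Δ^b of them; the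
-- non-landmarks outside all such components share the representation 0 … 0. Splitting off one
-- component at a time and using Δ^t + Δ^t ≤ Δ^(t+1) leaves at most Δ^d + 1 non-landmarks, so
-- n ≤ d + Δ^d + 1 ≤ 2Δ^d − 1 unless d = 1 and Δ = 2. In that case, if κ(x,w) = 2, one of the
-- two paths from x to w passes through a vertex of w's component other than x and w, which by
-- injectivity must be the vertex y with κ(y,w) = 1; but then y–w and y–x–w are two paths. So the
-- values 1 and 2 do not both occur and n ≤ 3.
--
-- The connectivities κ exist only under double negation, which suffices since the conclusion is
-- decidable.
module Submission where

open import Defs
open import Level using (0ℓ)
open import Data.Nat
  using (ℕ; zero; suc; pred; _≤_; _+_; _*_; _^_; _%_; z≤n; s≤s; s≤s⁻¹; NonZero; >-nonZero;
         _≤?_)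
  renaming (_≟_ to _≟ℕ_)
open import Data.Nat.Properties
  using (≤-refl; ≤-trans; ≤-reflexive; ≤-antisym; ≤∧≢⇒<; m≤n⇒m<n∨m≡n; n≤1+n; +-suc;
         +-identityʳ; +-assoc; +-mono-≤; +-monoˡ-≤; +-monoʳ-≤; *-mono-≤; *-monoˡ-≤;
         *-identityʳ; ^-monoʳ-≤; m≤n⇒m≤n⊔o; m≤n⇒m≤o⊔n; module ≤-Reasoning)
open import Data.Nat.DivMod using (_mod_; m<n⇒m%n≡m)
open import Data.Nat.Tactic.RingSolver using (solve-∀)
open import Data.Bool using (T)
open import Data.Bool.Properties using (T?)
open import Data.Fin using (Fin; zero; suc; toℕ; funToFin; finToFun; _≟_)
open import Data.Fin.Properties
  using (injective⇒≤; toℕ-fromℕ<; finToFun-funToFin; any?; all?; sequence)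
open import Data.List using (List; []; _∷_; _++_; [_]; length; filter; map; allFin; lookup)
open import Data.List.Properties
  using (length-filter; filter-notAll; foldr-preservesᵒ; length-++; length-map; length-tabulate)
open import Data.List.Membership.Propositional using (_∈_)
open import Data.List.Membership.Propositional.Properties
  using (∈-lookup; ∈-∃++; ∈-++⁺ˡ; ∈-++⁺ʳ; ∈-filter⁺; ∈-filter⁻; ∈-map⁺;
         ∈-allFin)
open import Data.List.Relation.Unary.Any as Any using (here; there; index)
open import Data.List.Relation.Unary.Any.Properties using (lookup-index)
open import Data.List.Relation.Unary.All as All using ([]; _∷_)
import Data.List.Relation.Unary.All.Properties as All
open import Data.List.Relation.Unary.Linked using ([-]; _∷_)
open import Data.List.Relation.Unary.AllPairs using ([]; _∷_)
open import Data.List.Relation.Unary.Unique.Propositional using (Unique)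
open import Data.List.Relation.Unary.Unique.Propositional.Properties using (filter⁺; allFin⁺)
open import Data.Maybe using (just; nothing)
open import Data.Maybe.Properties using (just-injective; ≡-dec)
open import Data.Product using (_×_; _,_; proj₁; proj₂; ∃-syntax)
open import Data.Sum using (_⊎_; inj₁; inj₂; [_,_]′)
open import Data.Empty using (⊥; ⊥-elim)
open import Effect.Monad using (RawMonad)
open import Function using (_∘_; id; case_of_)
open import Function.Definitions using (Injective)
open import Relation.Binary using (Rel; DecidableEquality)
open import Relation.Binary.Construct.Closure.ReflexiveTransitive
  using (Star; ε; _◅_; _◅◅_; reverse)
open import Relation.Binary.PropositionalEquality
  using (_≡_; _≢_; refl; sym; trans; cong; subst; subst₂; module ≡-Reasoning)
open import Relation.Nullary using (¬_; Dec; yes; no; ¬?; contradiction)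
open import Relation.Nullary.Decidable using (decidable-stable; ¬¬-excluded-middle)
open import Relation.Nullary.Negation using (¬¬-Monad; ¬¬-map)
open import Relation.Nullary.Negation.Core using (DoubleNegation)
open import Relation.Unary using (Pred; Decidable)
open import Relation.Unary.Properties using (∁?)

open RawMonad (¬¬-Monad {0ℓ}) using (pure; _>>=_; rawApplicative)

module _ {A : Set} where

  lookup-injective : ∀ {xs : List A} → Unique xs → ∀ {i j} →
                     lookup xs i ≡ lookup xs j → i ≡ j
  lookup-injective {_ ∷ _} _          {zero}  {zero}  _  = refl
  lookup-injective {_ ∷ _} (x∉xs ∷ _) {zero}  {suc j} eq =
    contradiction eq (All.lookup x∉xs (∈-lookup j))
  lookup-injective {_ ∷ _} (x∉xs ∷ _) {suc i} {zero}  eq =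
    contradiction (sym eq) (All.lookup x∉xs (∈-lookup i))
  lookup-injective {_ ∷ _} (_ ∷ xs!)  {suc i} {suc j} eq = cong suc (lookup-injective xs! eq)

  Unique⇒length≤ : ∀ {xs : List A} {m} → Unique xs → (f : A → Fin m) →
                   (∀ {x y} → x ∈ xs → y ∈ xs → f x ≡ f y → x ≡ y) → length xs ≤ m
  Unique⇒length≤ {xs} xs! f f-inj =
    injective⇒≤ {f = f ∘ lookup xs} (lookup-injective xs! ∘ f-inj (∈-lookup _) (∈-lookup _))

  length≤1 : ∀ {xs : List A} → Unique xs → (∀ {x y} → x ∈ xs → y ∈ xs → x ≡ y) →
             length xs ≤ 1
  length≤1 xs! all-equal = Unique⇒length≤ xs! (λ _ → zero) λ x∈ y∈ _ → all-equal x∈ y∈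

  injective-into⇒≤ : ∀ {k} {f : Fin k → A} → Injective _≡_ _≡_ f →
                     (xs : List A) → (∀ i → f i ∈ xs) → k ≤ length xs
  injective-into⇒≤ {f = f} f-inj xs f∈xs = injective⇒≤ {f = index ∘ f∈xs} λ {i} {j} eq →
    let open ≡-Reasoning in f-inj (begin
      f i                        ≡⟨ lookup-index (f∈xs i) ⟩
      lookup xs (index (f∈xs i)) ≡⟨ cong (lookup xs) eq ⟩
      lookup xs (index (f∈xs j)) ≡⟨ lookup-index (f∈xs j) ⟨
      f j                        ∎)

  length-filter-partition : {P : Pred A 0ℓ} (P? : Decidable P) (xs : List A) →
                            length (filter P? xs) + length (filter (∁? P?) xs) ≡ length xs
  length-filter-partition P? []       = refl
  length-filter-partition P? (x ∷ xs) with P? x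
  ... | yes _ = cong suc (length-filter-partition P? xs)
  ... | no  _ = trans (+-suc _ _) (cong suc (length-filter-partition P? xs))

¬¬-largest : (P : ℕ → Set) → P 0 → ∀ N →
             DoubleNegation (∃[ k ] P k × (∀ m → P m → m ≤ N → m ≤ k))
¬¬-largest P p₀ zero    = pure (0 , p₀ , λ _ _ → id)
¬¬-largest P p₀ (suc N) = do
  (k , pₖ , k-largest) ← ¬¬-largest P p₀ N
  P[1+N]? ← ¬¬-excluded-middle
  pure (case P[1+N]? of λ where
    (yes p[1+N]) → suc N , p[1+N] , λ _ _ → id
    (no ¬p[1+N]) → k , pₖ , λ m pₘ m≤1+N →
      k-largest m pₘ (s≤s⁻¹ (≤∧≢⇒< m≤1+N λ { refl → ¬p[1+N] pₘ })))

x+x≤m*x : ∀ {m} x → 2 ≤ m → x + x ≤ m * x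
x+x≤m*x x 2≤m = ≤-trans (≤-reflexive (cong (x +_) (sym (+-identityʳ x)))) (*-monoˡ-≤ x 2≤m)

a+b≤m*x+1 : ∀ {m a b x} → 2 ≤ m → a ≤ x → b ≤ x + 1 → a + b ≤ m * x + 1
a+b≤m*x+1 {m} {a} {b} {x} 2≤m a≤x b≤x+1 = begin
  a + b       ≤⟨ +-mono-≤ a≤x b≤x+1 ⟩
  x + (x + 1) ≡⟨ +-assoc x x 1 ⟨
  x + x + 1   ≤⟨ +-monoˡ-≤ 1 (x+x≤m*x x 2≤m) ⟩
  m * x + 1   ∎
  where open ≤-Reasoning

2+d≤m^d : ∀ {m} t → 2 ≤ m → 2 + (2 + t) ≤ m ^ (2 + t)
2+d≤m^d zero        2≤m = *-mono-≤ 2≤m (*-mono-≤ 2≤m ≤-refl)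
2+d≤m^d {m} (suc t) 2≤m =
  ≤-trans (+-mono-≤ (≤-trans (s≤s z≤n) ih) ih) (x+x≤m*x (m ^ (2 + t)) 2≤m)
  where ih = 2+d≤m^d t 2≤m

n+1≤2*x : ∀ {n d x} → n ≤ d + (x + 1) → 2 + d ≤ x → n + 1 ≤ 2 * x
n+1≤2*x {n} {d} {x} n≤d+x+1 2+d≤x = begin
  n + 1           ≤⟨ +-monoˡ-≤ 1 n≤d+x+1 ⟩
  d + (x + 1) + 1 ≡⟨ rearrange d x ⟩
  (2 + d) + x     ≤⟨ +-monoˡ-≤ x 2+d≤x ⟩
  x + x           ≤⟨ x+x≤m*x x ≤-refl ⟩
  2 * x           ∎
  where
  open ≤-Reasoning
  rearrange : ∀ d x → d + (x + 1) + 1 ≡ (2 + d) + x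
  rearrange = solve-∀

module _ {n} (G : Graph n) where

  private variable
    u v w x y : Fin n
    us : List (Fin n)
    k : ℕ

  Adjacent : Rel (Fin n) 0ℓ
  Adjacent u v = T (adj G u v)

  adjacent-sym : Adjacent u v → Adjacent v u
  adjacent-sym {u} {v} = subst T (adj-sym G u v)

  adjacent-irrefl : Adjacent u v → u ≢ v
  adjacent-irrefl {u} u~u refl = subst T (irrefl G u) u~u

  Connected : Rel (Fin n) 0ℓ
  Connected = Star Adjacent

  connected-sym : Connected u v → Connected v u
  connected-sym = reverse adjacent-sym

  path-ends-distinct : IsPath G v w us → v ≢ w
  path-ends-distinct {us = us} (_ , v∉ ∷ _) = All.lookup v∉ (∈-++⁺ʳ us (here refl))

  path⇒connected : IsPath G v w us → Connected v w
  path⇒connected {us = []}    (v~w ∷ [-] , _)    = v~w ◅ ε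
  path⇒connected {us = _ ∷ _} (v~u ∷ l , _ ∷ u!) = v~u ◅ path⇒connected (l , u!)

  path-suffix : ∀ ys {zs} → IsPath G v w (ys ++ u ∷ zs) → IsPath G u w zs
  path-suffix []       (_ ∷ l , _ ∷ u!) = l , u!
  path-suffix (_ ∷ ys) (_ ∷ l , _ ∷ u!) = path-suffix ys (l , u!)

  path-from-interior : IsPath G v w us → u ∈ us → ∃[ zs ] IsPath G u w zs
  path-from-interior p u∈us with ys , zs , refl ← ∈-∃++ u∈us = zs , path-suffix ys p

  interior≢source : IsPath G v w us → u ∈ us → u ≢ v
  interior≢source (_ , v∉ ∷ _) u∈us u≡v = All.lookup v∉ (∈-++⁺ˡ u∈us) (sym u≡v)

  interior≢target : IsPath G v w us → u ∈ us → u ≢ w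
  interior≢target p u∈us = path-ends-distinct (proj₂ (path-from-interior p u∈us))

  -- Loop erasure: if u recurs on the path from v, the path restarts at that occurrence.
  connected⇒path : Connected u w → u ≢ w → ∃[ us ] IsPath G u w us
  connected⇒path ε u≢w = contradiction refl u≢w
  connected⇒path {u} {w} (_◅_ {j = v} u~v v~w) u≢w with v ≟ w
  ... | yes refl = [] , u~v ∷ [-] , (u≢w ∷ []) ∷ [] ∷ []
  ... | no  v≢w with connected⇒path v~w v≢w
  ...   | us , p with Any.any? (u ≟_) us
  ...     | yes u∈us = path-from-interior p u∈us
  ...     | no  u∉us = v ∷ us , u~v ∷ proj₁ p , u∉path ∷ proj₂ p
    where u∉path = adjacent-irrefl u~v ∷ All.++⁺ (All.¬Any⇒All¬ us u∉us) (u≢w ∷ [])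

  path⇒disjointPaths : IsPath G v w us → HasDisjointPaths G v w 1
  path⇒disjointPaths {us = us} p =
    (λ _ → us) , (λ _ → p) , λ { zero zero 0≢0 → contradiction refl 0≢0 }

  second : Fin n → List (Fin n) → Fin n
  second w []      = w
  second _ (u ∷ _) = u

  adjacent-second : IsPath G v w us → Adjacent v (second w us)
  adjacent-second {us = []}    (v~w ∷ _ , _) = v~w
  adjacent-second {us = _ ∷ _} (v~u ∷ _ , _) = v~u

  second-distinct : ∀ {us us′} → IsPath G v w us → IsPath G v w us′ → us ≢ us′ →
                    (∀ z → z ∈ us → z ∈ us′ → ⊥) → second w us ≢ second w us′
  second-distinct {us = []}    {[]}    _ _  us≢us′ _ _    = us≢us′ refl
  second-distinct {us = []}    {_ ∷ _} _ p′ _      _ w≡u′ = interior≢target p′ (here refl) (sym w≡u′)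
  second-distinct {us = _ ∷ _} {[]}    p _  _      _ u≡w  = interior≢target p (here refl) u≡w
  second-distinct {us = u ∷ _} {_ ∷ _} _ _  _   disj refl = disj u (here refl) (here refl)

  disjointPaths≤degree : HasDisjointPaths G v w k → k ≤ degree G v
  disjointPaths≤degree {v} {w} (P , paths , disjoint) = injective-into⇒≤ second-injective _
    λ i → ∈-filter⁺ (λ u → T? (adj G v u)) (∈-allFin _) (adjacent-second (paths i))
    where
    second-injective : Injective _≡_ _≡_ (λ i → second w (P i))
    second-injective {i} {j} eq = decidable-stable (i ≟ j) λ i≢j →
      let Pᵢ≢Pⱼ , disj = disjoint i j i≢j
      in second-distinct (paths i) (paths j) Pᵢ≢Pⱼ disj eq

  degree≤maxDegree : ∀ v → degree G v ≤ maxDegree G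
  degree≤maxDegree v = foldr-preservesᵒ (λ x y → [ m≤n⇒m≤n⊔o y , m≤n⇒m≤o⊔n x ]′) 0 _
    (inj₂ (Any.map ≤-reflexive (∈-map⁺ (degree G) (∈-allFin v))))

  disjointPaths≤maxDegree : HasDisjointPaths G v w k → k ≤ maxDegree G
  disjointPaths≤maxDegree {v} h = ≤-trans (disjointPaths≤degree h) (degree≤maxDegree v)

  triangle⇒disjointPaths : Adjacent x y → Adjacent y w → Adjacent x w → HasDisjointPaths G y w 2
  triangle⇒disjointPaths {x} {y} {w} x~y y~w x~w = P , paths , disjoint
    where
    y~x = adjacent-sym x~y
    P : Fin 2 → List (Fin n)
    P zero       = []
    P (suc zero) = [ x ]
    paths : ∀ i → IsPath G y w (P i)
    paths zero       = y~w ∷ [-] , (adjacent-irrefl y~w ∷ []) ∷ [] ∷ []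
    paths (suc zero) = y~x ∷ x~w ∷ [-] ,
      (adjacent-irrefl y~x ∷ adjacent-irrefl y~w ∷ []) ∷ (adjacent-irrefl x~w ∷ []) ∷ [] ∷ []
    disjoint : ∀ i j → i ≢ j → (P i ≢ P j) × (∀ z → z ∈ P i → z ∈ P j → ⊥)
    disjoint zero       zero       0≢0 = contradiction refl 0≢0
    disjoint zero       (suc zero) _   = (λ ()) , λ _ ()
    disjoint (suc zero) zero       _   = (λ ()) , λ _ _ ()
    disjoint (suc zero) (suc zero) 1≢1 = contradiction refl 1≢1

  edge+detour⇒disjointPaths : IsPath G x w [] → IsPath G x w [ y ] → HasDisjointPaths G y w 2
  edge+detour⇒disjointPaths (x~w ∷ [-] , _) (x~y ∷ y~w ∷ [-] , _) =
    triangle⇒disjointPaths x~y y~w x~w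

  interior-⊆-singleton : IsPath G x w us → (∀ {u} → u ∈ us → u ≡ y) →
                         us ≡ [] ⊎ us ≡ [ y ]
  interior-⊆-singleton {us = []}        _ _  = inj₁ refl
  interior-⊆-singleton {us = _ ∷ []}    _ ≡y = inj₂ (cong [_] (≡y (here refl)))
  interior-⊆-singleton {us = _ ∷ _ ∷ _} (_ , _ ∷ (u≢u′ ∷ _) ∷ _) ≡y =
    contradiction (trans (≡y (here refl)) (sym (≡y (there (here refl))))) u≢u′

  disjointPaths-via : (h : HasDisjointPaths G x w 2) → (∀ i {u} → u ∈ proj₁ h i → u ≡ y) →
                      HasDisjointPaths G y w 2
  disjointPaths-via {x} {w} {y} (P , paths , disjoint) ≡y
    with interior-⊆-singleton (paths zero) (≡y zero)
       | interior-⊆-singleton (paths (suc zero)) (≡y (suc zero))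
       | disjoint zero (suc zero) (λ ())
  ... | inj₁ P₀≡[]  | inj₁ P₁≡[]  | P₀≢P₁ , _ =
    contradiction (trans P₀≡[] (sym P₁≡[])) P₀≢P₁
  ... | inj₂ P₀≡[y] | inj₂ P₁≡[y] | _ , disj  =
    ⊥-elim (disj y (subst (y ∈_) (sym P₀≡[y]) (here refl)) (subst (y ∈_) (sym P₁≡[y]) (here refl)))
  ... | inj₁ P₀≡[]  | inj₂ P₁≡[y] | _ = edge+detour⇒disjointPaths
    (subst (IsPath G x w) P₀≡[] (paths zero)) (subst (IsPath G x w) P₁≡[y] (paths (suc zero)))
  ... | inj₂ P₀≡[y] | inj₁ P₁≡[]  | _ = edge+detour⇒disjointPaths
    (subst (IsPath G x w) P₁≡[] (paths (suc zero))) (subst (IsPath G x w) P₀≡[y] (paths zero))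

  Conn-functional : ∀ {c c′} → Conn G v w c → Conn G v w c′ → c ≡ c′
  Conn-functional (inj₁ (_ , c≡∞)) (inj₁ (_ , c′≡∞)) = trans c≡∞ (sym c′≡∞)
  Conn-functional (inj₁ (v≡w , _)) (inj₂ (v≢w , _))  = contradiction v≡w v≢w
  Conn-functional (inj₂ (v≢w , _)) (inj₁ (v≡w , _))  = contradiction v≡w v≢w
  Conn-functional (inj₂ (_ , k , c≡k , hₖ , k-max)) (inj₂ (_ , k′ , c′≡k′ , hₖ′ , k′-max)) =
    trans c≡k (trans (cong just (≤-antisym (k′-max k hₖ) (k-max k′ hₖ′))) (sym c′≡k′))

  ¬¬-Conn : ∀ v w → DoubleNegation (∃[ c ] Conn G v w c)
  ¬¬-Conn v w with v ≟ w
  ... | yes v≡w = pure (nothing , inj₁ (v≡w , refl))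
  ... | no  v≢w = do
    (k , hₖ , k-largest) ←
      ¬¬-largest (HasDisjointPaths G v w) ((λ ()) , (λ ()) , (λ ())) (maxDegree G)
    pure (just k , inj₂ (v≢w , k , refl , hₖ ,
                         λ m hₘ → k-largest m hₘ (disjointPaths≤maxDegree hₘ)))

  ¬¬-connectivity : DoubleNegation (∀ v w → ∃[ c ] Conn G v w c)
  ¬¬-connectivity = sequence rawApplicative λ v → sequence rawApplicative (¬¬-Conn v)

_≟∞_ : DecidableEquality ℕ∞
_≟∞_ = ≡-dec _≟ℕ_

module Connectivity {n} (G : Graph n) (conn : ∀ v w → ∃[ c ] Conn G v w c) where

  private variable
    c u v w : Fin n
    k m : ℕ

  Δ : ℕ
  Δ = maxDegree G

  κ : Fin n → Fin n → ℕ∞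
  κ v w = proj₁ (conn v w)

  κ-self : κ v v ≡ nothing
  κ-self {v} = Conn-functional G (proj₂ (conn v v)) (inj₁ (refl , refl))

  κ-bounded : v ≢ w → ∃[ k ] κ v w ≡ just k × k ≤ Δ
  κ-bounded {v} {w} v≢w with proj₂ (conn v w)
  ... | inj₁ (v≡w , _)              = contradiction v≡w v≢w
  ... | inj₂ (_ , k , κ≡k , hₖ , _) = k , κ≡k , disjointPaths≤maxDegree G hₖ

  κ-witness : κ v w ≡ just k → HasDisjointPaths G v w k
  κ-witness {v} {w} κ≡k with proj₂ (conn v w)
  ... | inj₁ (_ , κ≡∞)                 = contradiction (trans (sym κ≡∞) κ≡k) λ ()
  ... | inj₂ (_ , k′ , κ≡k′ , hₖ′ , _) =
    subst (HasDisjointPaths G v w) (just-injective (trans (sym κ≡k′) κ≡k)) hₖ′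

  κ-largest : κ v w ≡ just k → HasDisjointPaths G v w m → m ≤ k
  κ-largest {v} {w} {m = m} κ≡k hₘ with proj₂ (conn v w)
  ... | inj₁ (_ , κ≡∞)                    = contradiction (trans (sym κ≡∞) κ≡k) λ ()
  ... | inj₂ (_ , k′ , κ≡k′ , _ , k′-max) =
    subst (m ≤_) (just-injective (trans (sym κ≡k′) κ≡k)) (k′-max m hₘ)

  κ-positive⇒connected : κ v w ≡ just (suc k) → Connected G v w
  κ-positive⇒connected κ≡1+k = path⇒connected G (proj₁ (proj₂ (κ-witness κ≡1+k)) zero)

  connected⇒κ-positive : Connected G v w → v ≢ w → ∃[ k ] κ v w ≡ just (suc k) × suc k ≤ Δ
  connected⇒κ-positive v~w v≢w with κ-bounded v≢w
  ... | suc k , κ≡1+k , 1+k≤Δ = k , κ≡1+k , 1+k≤Δ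
  ... | zero  , κ≡0 , _       =
    contradiction (κ-largest κ≡0 (path⇒disjointPaths G (proj₂ (connected⇒path G v~w v≢w)))) λ ()

  disconnected⇒κ≡0 : ¬ Connected G v w → κ v w ≡ just 0
  disconnected⇒κ≡0 {v} {w} v≁w with v ≟ w
  ... | yes refl = contradiction ε v≁w
  ... | no  v≢w with κ-bounded v≢w
  ...   | zero  , κ≡0 , _   = κ≡0
  ...   | suc _ , κ≡1+k , _ = contradiction (κ-positive⇒connected κ≡1+k) v≁w

  outside-component⇒κ≡0 : ¬ Connected G c u → Connected G c w → κ u w ≡ just 0
  outside-component⇒κ≡0 c≁u c~w =
    disconnected⇒κ≡0 λ u~w → c≁u (c~w ◅◅ connected-sym G u~w)

  connected? : ∀ v w → Dec (Connected G v w)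
  connected? v w with v ≟ w
  ... | yes refl = yes ε
  ... | no  v≢w with κ-bounded v≢w
  ...   | suc _ , κ≡1+k , _ = yes (κ-positive⇒connected κ≡1+k)
  ...   | zero  , κ≡0 , _   = no λ v~w →
    let _ , κ≡1+k , _ = connected⇒κ-positive v~w v≢w
    in contradiction (trans (sym κ≡0) κ≡1+k) λ ()

  Resolves : ∀ {d} → (Fin d → Fin n) → Set
  Resolves W = ∀ {u v} → (∀ j → κ u (W j) ≡ κ v (W j)) → u ≡ v

  Resolving⇒Resolves : ∀ {d} {W : Fin d → Fin n} →
                       (∀ v₁ v₂ → SameRep G W v₁ v₂ → v₁ ≡ v₂) → Resolves W
  Resolving⇒Resolves {W = W} resolving {u} {v} agree = resolving u v λ j c₁ c₂ u-c₁ v-c₂ →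
    trans (Conn-functional G u-c₁ (proj₂ (conn u (W j))))
          (trans (agree j) (Conn-functional G (proj₂ (conn v (W j))) v-c₂))

  module _ (w : Fin n) (κ-w-injective : Injective _≡_ _≡_ (λ v → κ v w)) (Δ≤2 : Δ ≤ 2) where

    κ-values : ∀ v → κ v w ∈ nothing ∷ just 0 ∷ just 1 ∷ just 2 ∷ []
    κ-values v with v ≟ w
    ... | yes refl = here κ-self
    ... | no  v≢w with κ-bounded v≢w
    ...   | 0 , κ≡0 , _ = there (here κ≡0)
    ...   | 1 , κ≡1 , _ = there (there (here κ≡1))
    ...   | 2 , κ≡2 , _ = there (there (there (here κ≡2)))
    ...   | suc (suc (suc _)) , _ , k≤Δ = contradiction (≤-trans k≤Δ Δ≤2) λ { (s≤s (s≤s ())) }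

    κ≡1⇒κ≢2 : ∀ {x₁ x₂} → κ x₁ w ≡ just 1 → κ x₂ w ≢ just 2
    κ≡1⇒κ≢2 {x₁} {x₂} κ₁≡1 κ₂≡2 =
      contradiction (κ-largest κ₁≡1 (disjointPaths-via G h interior≡x₁)) λ { (s≤s ()) }
      where
      h = κ-witness κ₂≡2
      interior≡x₁ : ∀ i {u} → u ∈ proj₁ h i → u ≡ x₁
      interior≡x₁ i {u} u∈
        with p ← proj₁ (proj₂ h) i
        with connected⇒κ-positive (path⇒connected G (proj₂ (path-from-interior G p u∈)))
                                  (interior≢target G p u∈)
      ... | 0 , κ≡1 , _ = κ-w-injective (trans κ≡1 (sym κ₁≡1))
      ... | 1 , κ≡2 , _ =
        contradiction (κ-w-injective (trans κ≡2 (sym κ₂≡2))) (interior≢source G p u∈)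
      ... | suc (suc _) , _ , 3≤Δ = contradiction (≤-trans 3≤Δ Δ≤2) λ { (s≤s (s≤s ())) }

    omitting⇒≤ : ∀ c → (∀ v → κ v w ≢ c) →
                 n ≤ length (filter (λ c′ → ¬? (c′ ≟∞ c)) (nothing ∷ just 0 ∷ just 1 ∷ just 2 ∷ []))
    omitting⇒≤ c omitted = injective-into⇒≤ κ-w-injective _ λ v →
      ∈-filter⁺ (λ c′ → ¬? (c′ ≟∞ c)) (κ-values v) (omitted v)

    single-landmark-bound : n ≤ 3
    single-landmark-bound with any? (λ v → κ v w ≟∞ just 2)
    ... | no  ∄x₂         = omitting⇒≤ (just 2) λ v κ≡2 → ∄x₂ (v , κ≡2)
    ... | yes (x₂ , κ₂≡2) = omitting⇒≤ (just 1) λ v κ≡1 → κ≡1⇒κ≢2 κ≡1 κ₂≡2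

  module _ {d} (W : Fin d → Fin n) (2≤Δ : 2 ≤ Δ) where

    private instance
      Δ-nonZero : NonZero Δ
      Δ-nonZero = >-nonZero (≤-trans (s≤s z≤n) 2≤Δ)

    NonLandmark : Fin n → Set
    NonLandmark v = ∀ j → v ≢ W j

    Separates : List (Fin d) → List (Fin n) → Set
    Separates I L =
      ∀ {u v} → u ∈ L → v ∈ L → (∀ {j} → j ∈ I → κ u (W j) ≡ κ v (W j)) → u ≡ v

    -- Only the arguments just 1 … just Δ matter; they are sent to 0 … Δ - 1.
    digit : ℕ∞ → Fin Δ
    digit nothing  = 0 mod Δ
    digit (just k) = pred k mod Δ

    digit-injective : ∀ {a b} → suc a ≤ Δ → suc b ≤ Δ →
                      digit (just (suc a)) ≡ digit (just (suc b)) → a ≡ b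
    digit-injective {a} {b} a<Δ b<Δ eq = begin
      a             ≡⟨ m<n⇒m%n≡m a<Δ ⟨
      a % Δ         ≡⟨ toℕ-fromℕ< _ ⟨
      toℕ (a mod Δ) ≡⟨ cong toℕ eq ⟩
      toℕ (b mod Δ) ≡⟨ toℕ-fromℕ< _ ⟩
      b % Δ         ≡⟨ m<n⇒m%n≡m b<Δ ⟩
      b             ∎
      where open ≡-Reasoning

    digit-determines-κ : Connected G u w → Connected G v w → u ≢ w → v ≢ w →
                         digit (κ u w) ≡ digit (κ v w) → κ u w ≡ κ v w
    digit-determines-κ {u} {w} {v} u~w v~w u≢w v≢w eq
      with a , κu≡1+a , 1+a≤Δ ← connected⇒κ-positive u~w u≢w
         | b , κv≡1+b , 1+b≤Δ ← connected⇒κ-positive v~w v≢w = begin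
      κ u w        ≡⟨ κu≡1+a ⟩
      just (suc a) ≡⟨ cong (just ∘ suc) (digit-injective 1+a≤Δ 1+b≤Δ digits) ⟩
      just (suc b) ≡⟨ κv≡1+b ⟨
      κ v w        ∎
      where
      open ≡-Reasoning
      digits = subst₂ (λ c c′ → digit c ≡ digit c′) κu≡1+a κv≡1+b eq

    profile : (J : List (Fin d)) → Fin n → Fin (Δ ^ length J)
    profile J v = funToFin λ k → digit (κ v (W (lookup J k)))

    profile-injective : ∀ {J j} → profile J u ≡ profile J v → j ∈ J →
                        digit (κ u (W j)) ≡ digit (κ v (W j))
    profile-injective {u} {v} {J} eq j∈J = begin
      digit (κ u (W _))              ≡⟨ cong (digit ∘ κ u ∘ W) (lookup-index j∈J) ⟩
      digit (κ u (W (lookup J t)))   ≡⟨ finToFun-funToFin _ t ⟨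
      finToFun (profile J u) t       ≡⟨ cong (λ c → finToFun c t) eq ⟩
      finToFun (profile J v) t       ≡⟨ finToFun-funToFin _ t ⟩
      digit (κ v (W (lookup J t)))   ≡⟨ cong (digit ∘ κ v ∘ W) (lookup-index j∈J) ⟨
      digit (κ v (W _))              ∎
      where
      open ≡-Reasoning
      t = index j∈J

    inComponent outsideComponent : Fin n → List (Fin n) → List (Fin n)
    inComponent      c = filter (connected? c)
    outsideComponent c = filter (∁? (connected? c))

    landmarksIn : Fin n → List (Fin d) → List (Fin d)
    landmarksIn c = filter (connected? c ∘ W)

    component-bound : ∀ I {L} c → Unique L → (∀ {v} → v ∈ L → NonLandmark v) →
                      Separates I L → length (inComponent c L) ≤ Δ ^ length (landmarksIn c I)
    component-bound I {L} c L! nonLandmark separates =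
      Unique⇒length≤ (filter⁺ (connected? c) L!) (profile (landmarksIn c I)) λ u∈ v∈ eq →
        let u∈L , c~u = ∈-filter⁻ (connected? c) u∈
            v∈L , c~v = ∈-filter⁻ (connected? c) v∈
        in separates u∈L v∈L (agree u∈L v∈L c~u c~v eq)
      where
      agree : ∀ {u v} → u ∈ L → v ∈ L → Connected G c u → Connected G c v →
              profile (landmarksIn c I) u ≡ profile (landmarksIn c I) v →
              ∀ {j} → j ∈ I → κ u (W j) ≡ κ v (W j)
      agree {u} {v} u∈L v∈L c~u c~v eq {j} j∈I with connected? c (W j)
      ... | yes c~w = digit-determines-κ
        (connected-sym G c~u ◅◅ c~w) (connected-sym G c~v ◅◅ c~w)
        (nonLandmark u∈L j) (nonLandmark v∈L j)
        (profile-injective eq (∈-filter⁺ (connected? c ∘ W) j∈I c~w))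
      ... | no  c≁w = trans (disconnected⇒κ≡0 λ u~w → c≁w (c~u ◅◅ u~w))
                            (sym (disconnected⇒κ≡0 λ v~w → c≁w (c~v ◅◅ v~w)))

    outside⁻ : ∀ c L → u ∈ outsideComponent c L → u ∈ L × ¬ Connected G c u
    outside⁻ c L = ∈-filter⁻ (∁? (connected? c)) {xs = L}

    outside-agree : ∀ c L → u ∈ outsideComponent c L → v ∈ outsideComponent c L →
                    Connected G c w → κ u w ≡ κ v w
    outside-agree c L u∈ v∈ c~w =
      trans (outside-component⇒κ≡0 (proj₂ (outside⁻ c L u∈)) c~w)
            (sym (outside-component⇒κ≡0 (proj₂ (outside⁻ c L v∈)) c~w))

    outside-separated : ∀ {i I} L → Separates (i ∷ I) L → Separates I (outsideComponent (W i) L)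
    outside-separated {i} L separates u∈ v∈ agree =
      separates (proj₁ (outside⁻ (W i) L u∈)) (proj₁ (outside⁻ (W i) L v∈)) λ where
        (here refl) → outside-agree (W i) L u∈ v∈ ε
        (there j∈I) → agree j∈I

    nonLandmarks-bound : ∀ I {L} → Unique L → (∀ {v} → v ∈ L → NonLandmark v) →
                         Separates I L → length L ≤ Δ ^ length I + 1
    nonLandmarks-bound [] L! _ separates =
      ≤-trans (length≤1 L! λ u∈ v∈ → separates u∈ v∈ λ ()) (n≤1+n 1)
    nonLandmarks-bound (i ∷ I) {L} L! nonLandmark separates = begin
      length L                                ≡⟨ length-filter-partition (connected? wᵢ) L ⟨
      length (inComponent wᵢ L) + length rest ≤⟨ +-monoˡ-≤ _ inside-bound ⟩
      Δ ^ b + length rest                     ≤⟨ landmarks+rest ⟩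
      Δ ^ suc (length I) + 1                  ∎
      where
      open ≤-Reasoning
      wᵢ = W i
      b = length (landmarksIn wᵢ (i ∷ I))
      rest = outsideComponent wᵢ L
      rest! = filter⁺ (∁? (connected? wᵢ)) L!
      inside-bound = component-bound (i ∷ I) wᵢ L! nonLandmark separates
      rest-separated = outside-separated L separates
      landmarks+rest : Δ ^ b + length rest ≤ Δ ^ suc (length I) + 1
      landmarks+rest with All.all? (connected? wᵢ ∘ W) I
      ... | yes I⊆[wᵢ] = +-mono-≤ (^-monoʳ-≤ Δ (length-filter (connected? wᵢ ∘ W) (i ∷ I)))
        (length≤1 rest! λ u∈ v∈ → rest-separated u∈ v∈ λ j∈I →
          outside-agree wᵢ L u∈ v∈ (All.lookup I⊆[wᵢ] j∈I))
      ... | no  I⊈[wᵢ] = a+b≤m*x+1 2≤Δ (^-monoʳ-≤ Δ b≤|I|)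
        (nonLandmarks-bound I rest! (nonLandmark ∘ proj₁ ∘ outside⁻ wᵢ L) rest-separated)
        where
        b≤|I| = s≤s⁻¹ (filter-notAll (connected? wᵢ ∘ W) (i ∷ I)
                                     (there (All.¬All⇒Any¬ (connected? wᵢ ∘ W) I I⊈[wᵢ])))

    nonLandmark? : ∀ v → Dec (NonLandmark v)
    nonLandmark? v = all? λ j → ¬? (v ≟ W j)

    nonLandmarks : List (Fin n)
    nonLandmarks = filter nonLandmark? (allFin n)

    n≤d+nonLandmarks : n ≤ d + length nonLandmarks
    n≤d+nonLandmarks = begin
      n                                               ≤⟨ injective-into⇒≤ {f = id} id _ covered ⟩
      length (map W (allFin d) ++ nonLandmarks)       ≡⟨ length-++ (map W (allFin d)) ⟩
      length (map W (allFin d)) + length nonLandmarks ≡⟨ cong (_+ length nonLandmarks) length-landmarks ⟩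
      d + length nonLandmarks                         ∎
      where
      open ≤-Reasoning
      length-landmarks = trans (length-map W (allFin d)) (length-tabulate {n = d} id)
      covered : ∀ v → v ∈ map W (allFin d) ++ nonLandmarks
      covered v with any? (λ j → v ≟ W j)
      ... | yes (j , refl) = ∈-++⁺ˡ (∈-map⁺ W (∈-allFin j))
      ... | no  ∄j         =
        ∈-++⁺ʳ _ (∈-filter⁺ nonLandmark? (∈-allFin v) λ j v≡Wj → ∄j (j , v≡Wj))

    vertices-bound : Resolves W → n ≤ d + (Δ ^ d + 1)
    vertices-bound resolves = ≤-trans n≤d+nonLandmarks (+-monoʳ-≤ d
      (subst (λ t → length nonLandmarks ≤ Δ ^ t + 1) (length-tabulate {n = d} id)
        (nonLandmarks-bound (allFin d) (filter⁺ nonLandmark? (allFin⁺ n))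
          (proj₂ ∘ ∈-filter⁻ nonLandmark? {xs = allFin n})
          λ _ _ agree → resolves λ j → agree (∈-allFin j))))

  cdim-bound : ∀ {d} (W : Fin d → Fin n) → 2 ≤ Δ → Resolves W → n + 1 ≤ 2 * Δ ^ d
  cdim-bound {zero} W _ resolves =
    +-monoˡ-≤ 1 (injective⇒≤ {f = λ _ → zero {0}} λ _ → resolves λ ())
  cdim-bound {1} W 2≤Δ resolves with m≤n⇒m<n∨m≡n 2≤Δ
  ... | inj₁ 3≤Δ =
    n+1≤2*x (vertices-bound W 2≤Δ resolves) (subst (3 ≤_) (sym (*-identityʳ Δ)) 3≤Δ)
  ... | inj₂ 2≡Δ = subst (λ D → n + 1 ≤ 2 * D ^ 1) 2≡Δ (+-monoˡ-≤ 1 n≤3)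
    where
    n≤3 = single-landmark-bound (W zero) (λ eq → resolves λ { zero → eq }) (≤-reflexive (sym 2≡Δ))
  cdim-bound {suc (suc t)} W 2≤Δ resolves =
    n+1≤2*x (vertices-bound W 2≤Δ resolves) (2+d≤m^d t 2≤Δ)

theorem2p4 : ∀ n (G : Graph n) → 1 ≤ n → 2 ≤ maxDegree G →
    ∀ d → IsCdim G d → n + 1 ≤ 2 * maxDegree G ^ d
theorem2p4 n G _ 2≤Δ d ((W , _ , resolving) , _) =
  decidable-stable (n + 1 ≤? 2 * maxDegree G ^ d) (¬¬-map bound (¬¬-connectivity G))
  where
  bound : (∀ v w → ∃[ c ] Conn G v w c) → n + 1 ≤ 2 * maxDegree G ^ d
  bound conn = cdim-bound W 2≤Δ (Resolving⇒Resolves resolving)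
    where open Connectivity G conn
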